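{- If there exists a triangular orientable embedding of a split-complete graph $G_n$, then there exists an orientable embedding of $K_n$ of type $(6)$.
   Context: A graph $G_n$ is split-complete if its vertices can be labeled $1, 2, \dotsc, n-1, x_0, x_1$ so that the vertices $1,\dotsc,n-1$ are pairwise adjacent, and the neighborhoods of $x_0$ and of $x_1$ form a partition of $\{1,\dotsc,n-1\}$ (in particular $x_0,x_1$ are nonadjacent). Embeddings are cellular embeddings in closed orientable surfaces; the length of a face is the number of corners on its boundary walk; an embedding is triangular if all faces have length 3, and of type $(6)$ if exactly one face has length $6$ and all others have length $3$. -}

module Defs where

open import Data.Nat using (ℕ; zero; suc; _∸_; _<_; _≤_)
open import Data.Fin using (Fin; zero; suc; _≟_)
open import Data.Bool using (Bool; true; false; T; not)
open import Data.Product using (Σ; ∃; _×_; _,_; proj₁; proj₂)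
open import Data.Sum using (_⊎_; inj₁; inj₂)
open import Data.Empty using (⊥-elim)
open import Relation.Binary.PropositionalEquality
open import Relation.Nullary using (¬_; yes; no)
open import Relation.Nullary.Decidable using (⌊_⌋)
open import Relation.Binary.Construct.Closure.ReflexiveTransitive using (Star)
open import Function.Definitions using (Bijective)

record Graph (N : ℕ) : Set where
  field
    adj        : Fin N → Fin N → Bool
    adj-sym    : ∀ u v → adj u v ≡ adj v u
    adj-irrefl : ∀ v → adj v v ≡ false

iter : {A : Set} → (A → A) → ℕ → A → A
iter f zero    x = x
iter f (suc k) x = f (iter f k x)

module _ {N : ℕ} (G : Graph N) where
  open Graph G

  Dart : Set
  Dart = Σ (Fin N × Fin N) (λ p → T (adj (proj₁ p) (proj₂ p)))

  tail : Dart → Fin N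
  tail ((u , v) , _) = u

  headD : Dart → Fin N
  headD ((u , v) , _) = v

  rev : Dart → Dart
  rev ((u , v) , e) = (v , u) , subst T (adj-sym u v) e

  Connected : Set
  Connected = ∀ u v → Star (λ a b → T (adj a b)) u v

  record RotationSystem : Set where
    field
      ρ        : Dart → Dart
      ρ⁻¹      : Dart → Dart
      ρ-inv₁   : ∀ d → ρ (ρ⁻¹ d) ≡ d
      ρ-inv₂   : ∀ d → ρ⁻¹ (ρ d) ≡ d
      ρ-tail   : ∀ d → tail (ρ d) ≡ tail d
      ρ-cyclic : ∀ d d′ → tail d ≡ tail d′ → ∃ λ k → iter ρ k d ≡ d′

    -- face-tracing permutation; faces are its orbits, and the length of
    -- the face containing d (its number of corners) is the orbit size of d
    φ : Dart → Dart
    φ d = ρ (rev d)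

  -- Cellular embeddings of G in closed orientable surfaces, up to
  -- equivalence, correspond to rotation systems of the connected graph G
  -- (Heffter–Edmonds).
  record OrientableEmbedding : Set where
    field
      connected : Connected
      rot       : RotationSystem
    open RotationSystem rot public

  module _ (E : OrientableEmbedding) where
    open OrientableEmbedding E

    FaceLength : Dart → ℕ → Set
    FaceLength d k = 1 ≤ k × iter φ k d ≡ d
                     × (∀ j → 1 ≤ j → j < k → ¬ (iter φ j d ≡ d))

    SameFace : Dart → Dart → Set
    SameFace d d′ = ∃ λ k → iter φ k d ≡ d′

    Triangular : Set
    Triangular = ∀ d → FaceLength d 3

    Type6 : Set
    Type6 = Σ Dart λ d₀ → FaceLength d₀ 6
              × (∀ d → SameFace d₀ d ⊎ FaceLength d 3)

private
  ≟-sym : ∀ {n} (u v : Fin n) → ⌊ u ≟ v ⌋ ≡ ⌊ v ≟ u ⌋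
  ≟-sym u v with u ≟ v | v ≟ u
  ... | yes _ | yes _ = refl
  ... | no _  | no _  = refl
  ... | yes p | no q  = ⊥-elim (q (sym p))
  ... | no p  | yes q = ⊥-elim (p (sym q))

  ≟-diag : ∀ {n} (v : Fin n) → ⌊ v ≟ v ⌋ ≡ true
  ≟-diag v with v ≟ v
  ... | yes _ = refl
  ... | no p  = ⊥-elim (p refl)

K : (n : ℕ) → Graph n
K n = record
  { adj        = λ u v → not ⌊ u ≟ v ⌋
  ; adj-sym    = λ u v → cong not (≟-sym u v)
  ; adj-irrefl = λ v → cong not (≟-diag v)
  }

-- G is split-complete with parameter n: its vertices can be labelled
-- 1,…,n-1 (here inj₁ i, i : Fin (n ∸ 1)) and x₀, x₁ (inj₂ 0, inj₂ 1)
-- bijectively, such that 1,…,n-1 are pairwise adjacent, x₀ x₁ are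
-- nonadjacent, and N(x₀), N(x₁) partition {1,…,n-1} (each i is adjacent
-- to exactly one of x₀, x₁; both blocks nonempty).
IsSplitComplete : (n : ℕ) {N : ℕ} → Graph N → Set
IsSplitComplete n {N} G =
  Σ (Fin (n ∸ 1) ⊎ Fin 2 → Fin N) λ ℓ →
    Bijective _≡_ _≡_ ℓ
    × (∀ i j → ¬ (i ≡ j) → adj (ℓ (inj₁ i)) (ℓ (inj₁ j)) ≡ true)
    × adj (ℓ (inj₂ zero)) (ℓ (inj₂ (suc zero))) ≡ false
    × (∀ i → adj (ℓ (inj₂ zero)) (ℓ (inj₁ i))
              ≡ not (adj (ℓ (inj₂ (suc zero))) (ℓ (inj₁ i))))
    × (∃ λ i → adj (ℓ (inj₂ zero)) (ℓ (inj₁ i)) ≡ true)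
    × (∃ λ i → adj (ℓ (inj₂ (suc zero))) (ℓ (inj₁ i)) ≡ true)
  where open Graph G

{-# OPTIONS --safe #-}
module Submission where

-- Label the vertices of G as 1, …, n−1, x₀, x₁ and identify x₀ with x₁ to a single vertex 0.
-- Because N(x₀) and N(x₁) partition {1, …, n−1}, this maps the darts of G bijectively onto
-- the darts of Kₙ, but x₀ and x₁ each carry their own rotation cycle. Composing the rotation ρ
-- with the transposition of a dart at x₀ and a dart at x₁ merges these two cycles into one.
-- On faces, φ = ρ ∘ rev becomes φ composed with the transposition of their reverses A and B,
-- which end at x₀ and x₁. As x₀ and x₁ are distinct and nonadjacent, A and B lie on
-- different triangles, so exactly these two triangles are glued into a hexagon.

open import Defs
open import Data.Nat using (ℕ; zero; suc; _+_; _*_; _<_; _≤_; s≤s; z≤n)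
open import Data.Nat.Properties using (*-suc)
open import Data.Fin using (Fin; zero; suc; _≟_)
open import Data.Fin.Properties using (suc-injective)
open import Data.Bool using (true; false; T; not)
open import Data.Bool.Properties using (T-irrelevant)
open import Data.Product using (∃; _×_; _,_; proj₁; proj₂)
open import Data.Product.Properties using (≡-dec)
open import Data.Sum using (_⊎_; inj₁; inj₂; [_,_]) renaming (map to ⊎-map)
open import Data.Empty using (⊥; ⊥-elim)
open import Data.Unit using (tt)
open import Function using (_∘_)
open import Function.Definitions using (Injective; Bijective)
open import Relation.Binary.Definitions using (DecidableEquality)
open import Relation.Binary.PropositionalEquality hiding ([_])
open import Relation.Nullary using (¬_; yes; no; Dec; contradiction)
open import Relation.Nullary.Decidable using (_⊎-dec_; fromWitnessFalse; toWitnessFalse)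
open import Relation.Binary.Construct.Closure.ReflexiveTransitive using (ε; _◅_)

module _ {A : Set} (f : A → A) where

  iter-sucʳ : ∀ k x → iter f (suc k) x ≡ iter f k (f x)
  iter-sucʳ zero    x = refl
  iter-sucʳ (suc k) x = cong f (iter-sucʳ k x)

  iter-+ : ∀ j k x → iter f (j + k) x ≡ iter f j (iter f k x)
  iter-+ zero    k x = refl
  iter-+ (suc j) k x = cong f (iter-+ j k x)

  iter-periodic : ∀ {p x} → iter f p x ≡ x → ∀ t → iter f (t * p) x ≡ x
  iter-periodic         fᵖx≡x zero    = refl
  iter-periodic {p} {x} fᵖx≡x (suc t) = begin
    iter f (p + t * p) x        ≡⟨ iter-+ p (t * p) x ⟩
    iter f p (iter f (t * p) x) ≡⟨ cong (iter f p) (iter-periodic fᵖx≡x t) ⟩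
    iter f p x                  ≡⟨ fᵖx≡x ⟩
    x                           ∎
    where open ≡-Reasoning

  iter-injective : Injective _≡_ _≡_ f → ∀ k {x y} → iter f k x ≡ iter f k y → x ≡ y
  iter-injective f-inj zero    e = e
  iter-injective f-inj (suc k) e = iter-injective f-inj k (f-inj e)

  Reach : A → A → Set
  Reach x y = ∃ λ k → iter f k x ≡ y

  reach-refl : ∀ {x} → Reach x x
  reach-refl = 0 , refl

  reach-trans : ∀ {x y z} → Reach x y → Reach y z → Reach x z
  reach-trans {x} (j , fʲx≡y) (k , fᵏy≡z) =
    k + j , trans (iter-+ k j x) (trans (cong (iter f k) fʲx≡y) fᵏy≡z)

  reach-step : ∀ {x y z} → f x ≡ y → Reach y z → Reach x z
  reach-step {x} refl (k , fᵏfx≡z) = suc k , trans (iter-sucʳ k x) fᵏfx≡z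

  reach-cycle : Injective _≡_ _≡_ f → ∀ {x a} → Reach x a → Reach (f a) a → Reach a x
  reach-cycle f-inj {x} {a} (j , fʲx≡a) (q , fᵠfa≡a) = j * q , iter-injective f-inj j (begin
    iter f j (iter f (j * q) a) ≡⟨ iter-+ j (j * q) a ⟨
    iter f (j + j * q) a        ≡⟨ cong (λ k → iter f k a) (*-suc j q) ⟨
    iter f (j * suc q) a        ≡⟨ iter-periodic (trans (iter-sucʳ q a) fᵠfa≡a) j ⟩
    a                           ≡⟨ fʲx≡a ⟨
    iter f j x                  ∎)
    where open ≡-Reasoning

  OrbitLength : A → ℕ → Set
  OrbitLength x k = 1 ≤ k × iter f k x ≡ x × (∀ j → 1 ≤ j → j < k → ¬ (iter f j x ≡ x))

module _ {A B : Set} (κ : A → B) {f : A → A} {F : B → B} (F∘κ≗κ∘f : ∀ x → F (κ x) ≡ κ (f x)) where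

  iter-map : ∀ k x → iter F k (κ x) ≡ κ (iter f k x)
  iter-map zero    x = refl
  iter-map (suc k) x = trans (cong F (iter-map k x)) (F∘κ≗κ∘f (iter f k x))

  reach-map : ∀ {x y} → Reach f x y → Reach F (κ x) (κ y)
  reach-map {x} (k , fᵏx≡y) = k , trans (iter-map k x) (cong κ fᵏx≡y)

  orbitLength-map : Injective _≡_ _≡_ κ → ∀ {x k} → OrbitLength f x k → OrbitLength F (κ x) k
  orbitLength-map κ-inj {x} {k} (1≤k , fᵏx≡x , minimal) =
      1≤k
    , trans (iter-map k x) (cong κ fᵏx≡x)
    , λ j 1≤j j<k Fʲκx≡κx → minimal j 1≤j j<k (κ-inj (trans (sym (iter-map j x)) Fʲκx≡κx))

_∈[_,_] : {A : Set} → A → A → A → Set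
x ∈[ a , b ] = x ≡ a ⊎ x ≡ b

module Transposition {A : Set} (_≟_ : DecidableEquality A) where

  _∈[_,_]? : ∀ x a b → Dec (x ∈[ a , b ])
  x ∈[ a , b ]? = (x ≟ a) ⊎-dec (x ≟ b)

  swap : A → A → A → A
  swap a b x with x ≟ a
  ... | yes _ = b
  ... | no _ with x ≟ b
  ...   | yes _ = a
  ...   | no _  = x

  swap-a : ∀ a b → swap a b a ≡ b
  swap-a a b with a ≟ a
  ... | yes _   = refl
  ... | no a≢a = contradiction refl a≢a

  swap-b : ∀ a b → swap a b b ≡ a
  swap-b a b with b ≟ a
  ... | yes b≡a = b≡a
  ... | no _ with b ≟ b
  ...   | yes _   = refl
  ...   | no b≢b = contradiction refl b≢b

  swap-other : ∀ {a b x} → ¬ x ∈[ a , b ] → swap a b x ≡ x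
  swap-other {a} {b} {x} x∉ with x ≟ a
  ... | yes x≡a = contradiction (inj₁ x≡a) x∉
  ... | no _ with x ≟ b
  ...   | yes x≡b = contradiction (inj₂ x≡b) x∉
  ...   | no _ = refl

  swap-involutive : ∀ a b x → swap a b (swap a b x) ≡ x
  swap-involutive a b x with x ∈[ a , b ]?
  ... | yes (inj₁ refl) = trans (cong (swap _ b) (swap-a _ b)) (swap-b _ b)
  ... | yes (inj₂ refl) = trans (cong (swap a _) (swap-b a _)) (swap-a a _)
  ... | no x∉ = trans (cong (swap a b) (swap-other x∉)) (swap-other x∉)

  swap-natural : ∀ {h : A → A} → Injective _≡_ _≡_ h
               → ∀ a b x → h (swap a b x) ≡ swap (h a) (h b) (h x)
  swap-natural {h} h-inj a b x with x ∈[ a , b ]?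
  ... | yes (inj₁ refl) = trans (cong h (swap-a _ b)) (sym (swap-a (h _) (h b)))
  ... | yes (inj₂ refl) = trans (cong h (swap-b a _)) (sym (swap-b (h a) (h _)))
  ... | no x∉ = trans (cong h (swap-other x∉)) (sym (swap-other (x∉ ∘ ⊎-map h-inj h-inj)))

-- A permutation whose cycles are exactly the fibres of col; a rotation system is the case
-- col = tail.
record FibreCycles {A C : Set} (col : A → C) : Set where
  field
    σ σ⁻¹    : A → A
    σ-σ⁻¹    : ∀ x → σ (σ⁻¹ x) ≡ x
    σ⁻¹-σ    : ∀ x → σ⁻¹ (σ x) ≡ x
    col-σ    : ∀ x → col (σ x) ≡ col x
    σ-cyclic : ∀ x y → col x ≡ col y → Reach σ x y

  σ-injective : Injective _≡_ _≡_ σ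
  σ-injective {x} {y} e = trans (sym (σ⁻¹-σ x)) (trans (cong σ⁻¹ e) (σ⁻¹-σ y))

module _ {A B C : Set} {colA : A → C} {colB : B → C} (κ : A → B) (β : B → A)
         (κ∘β : ∀ y → κ (β y) ≡ y) (β∘κ : ∀ x → β (κ x) ≡ x)
         (colB∘κ : ∀ x → colB (κ x) ≡ colA x) where

  transportFibreCycles : FibreCycles colA → FibreCycles colB
  transportFibreCycles P = record
    { σ        = κ ∘ σ ∘ β
    ; σ⁻¹      = κ ∘ σ⁻¹ ∘ β
    ; σ-σ⁻¹    = λ y → trans (cong (κ ∘ σ) (β∘κ _)) (trans (cong κ (σ-σ⁻¹ _)) (κ∘β y))
    ; σ⁻¹-σ    = λ y → trans (cong (κ ∘ σ⁻¹) (β∘κ _)) (trans (cong κ (σ⁻¹-σ _)) (κ∘β y))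
    ; col-σ    = λ y → trans (colB∘κ _) (trans (col-σ _) (colA∘β y))
    ; σ-cyclic = cyclic
    }
    where
    open FibreCycles P
    colA∘β : ∀ y → colA (β y) ≡ colB y
    colA∘β y = trans (sym (colB∘κ (β y))) (cong colB (κ∘β y))
    cyclic : ∀ y z → colB y ≡ colB z → Reach (κ ∘ σ ∘ β) y z
    cyclic y z e = subst₂ (Reach (κ ∘ σ ∘ β)) (κ∘β y) (κ∘β z)
      (reach-map κ (λ x → cong (κ ∘ σ) (β∘κ x))
        (σ-cyclic (β y) (β z) (trans (colA∘β y) (trans e (sym (colA∘β z))))))

module Splice {A C D : Set} (_≟_ : DecidableEquality A) {col : A → C} (P : FibreCycles col)
  (a b : A) (col-a≢col-b : col a ≢ col b)
  (μ : C → D) (μ-a≡μ-b : μ (col a) ≡ μ (col b))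
  (μ-fibres : ∀ {c c′} → μ c ≡ μ c′ → c ≡ c′ ⊎ (c ∈[ col a , col b ] × c′ ∈[ col a , col b ]))
  where
  open FibreCycles P
  open Transposition _≟_

  g g⁻¹ : A → A
  g   = σ ∘ swap a b
  g⁻¹ = swap a b ∘ σ⁻¹

  g-other : ∀ {x} → ¬ x ∈[ a , b ] → g x ≡ σ x
  g-other x∉ = cong σ (swap-other x∉)

  g-injective : Injective _≡_ _≡_ g
  g-injective {x} {y} e =
    trans (sym (swap-involutive a b x)) (trans (cong (swap a b) (σ-injective e)) (swap-involutive a b y))

  μcol-swap : ∀ x → μ (col (swap a b x)) ≡ μ (col x)
  μcol-swap x with x ∈[ a , b ]?
  ... | yes (inj₁ refl) = trans (cong (μ ∘ col) (swap-a _ b)) (sym μ-a≡μ-b)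
  ... | yes (inj₂ refl) = trans (cong (μ ∘ col) (swap-b a _)) μ-a≡μ-b
  ... | no x∉ = cong (μ ∘ col) (swap-other x∉)

  ends-separated : ∀ {p q} → p ∈[ a , b ] → q ∈[ a , b ] → col p ≡ col q → p ≡ q
  ends-separated (inj₁ refl) (inj₁ refl) _ = refl
  ends-separated (inj₂ refl) (inj₂ refl) _ = refl
  ends-separated (inj₁ refl) (inj₂ refl) e = contradiction e col-a≢col-b
  ends-separated (inj₂ refl) (inj₁ refl) e = contradiction (sym e) col-a≢col-b

  -- g follows σ until the walk meets a or b.
  follow : ∀ {x y} → Reach σ x y
         → Reach g x y ⊎ ∃ λ p → p ∈[ a , b ] × col p ≡ col x × Reach g x p
  follow (k , σᵏx≡y) = walk k σᵏx≡y
    where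
    walk : ∀ k {x y} → iter σ k x ≡ y
         → Reach g x y ⊎ ∃ λ p → p ∈[ a , b ] × col p ≡ col x × Reach g x p
    walk zero    refl = inj₁ (reach-refl g)
    walk (suc k) {x} σᵏ⁺¹x≡y with x ∈[ a , b ]?
    ... | yes x∈ = inj₂ (x , x∈ , refl , reach-refl g)
    ... | no x∉ with walk k (trans (sym (iter-sucʳ σ k x)) σᵏ⁺¹x≡y)
    ...   | inj₁ r = inj₁ (reach-step g (g-other x∉) r)
    ...   | inj₂ (p , p∈ , colp≡colσx , r) =
            inj₂ (p , p∈ , trans colp≡colσx (col-σ x) , reach-step g (g-other x∉) r)

  reach-end : ∀ {x p} → p ∈[ a , b ] → col x ≡ col p → Reach g x p
  reach-end {x} p∈ colx≡colp with follow (σ-cyclic x _ colx≡colp)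
  ... | inj₁ r = r
  ... | inj₂ (q , q∈ , colq≡colx , r) =
        subst (Reach g x) (ends-separated q∈ p∈ (trans colq≡colx colx≡colp)) r

  reach-a : ∀ {x} → col x ∈[ col a , col b ] → Reach g x a
  reach-a (inj₁ colx≡cola) = reach-end (inj₁ refl) colx≡cola
  reach-a (inj₂ colx≡colb) =
    reach-trans g (reach-end (inj₂ refl) colx≡colb)
      (reach-step g (cong σ (swap-b a b)) (reach-end (inj₁ refl) (col-σ a)))

  -- Every dart of the merged fibre reaches a, and a lies on a cycle of the injective g.
  merged-cyclic : ∀ {x y} → col x ∈[ col a , col b ] → col y ∈[ col a , col b ] → Reach g x y
  merged-cyclic x∈ y∈ = reach-trans g (reach-a x∈) (reach-cycle g g-injective (reach-a y∈) (reach-a ga∈))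
    where
    ga∈ : col (g a) ∈[ col a , col b ]
    ga∈ = inj₂ (trans (cong (col ∘ σ) (swap-a a b)) (col-σ b))

  end-colour : ∀ {x p} → p ∈[ a , b ] → col x ≡ col p → col x ∈[ col a , col b ]
  end-colour (inj₁ refl) e = inj₁ e
  end-colour (inj₂ refl) e = inj₂ e

  g-cyclic : ∀ x y → μ (col x) ≡ μ (col y) → Reach g x y
  g-cyclic x y e with μ-fibres e
  ... | inj₂ (x∈ , y∈) = merged-cyclic x∈ y∈
  ... | inj₁ colx≡coly with follow (σ-cyclic x y colx≡coly)
  ...   | inj₁ r = r
  ...   | inj₂ (p , p∈ , colp≡colx , _) =
          merged-cyclic (end-colour p∈ (sym colp≡colx))
                        (end-colour p∈ (trans (sym colx≡coly) (sym colp≡colx)))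

  spliced : FibreCycles (μ ∘ col)
  spliced = record
    { σ        = g
    ; σ⁻¹      = g⁻¹
    ; σ-σ⁻¹    = λ x → trans (cong σ (swap-involutive a b _)) (σ-σ⁻¹ x)
    ; σ⁻¹-σ    = λ x → trans (cong (swap a b) (σ⁻¹-σ _)) (swap-involutive a b x)
    ; col-σ    = λ x → trans (cong μ (col-σ _)) (μcol-swap x)
    ; σ-cyclic = g-cyclic
    }

OnTriangle : {A : Set} → (A → A) → A → A → Set
OnTriangle φ x y = x ≡ y ⊎ φ x ≡ y ⊎ φ (φ x) ≡ y

module Triangles {A : Set} (φ : A → A) (triangular : ∀ x → OrbitLength φ x 3) where

  φ³ : ∀ x → φ (φ (φ x)) ≡ x
  φ³ x = proj₁ (proj₂ (triangular x))

  φ-no-fixpoint : ∀ x → φ x ≢ x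
  φ-no-fixpoint x = proj₂ (proj₂ (triangular x)) 1 (s≤s z≤n) (s≤s (s≤s z≤n))

  φ²-no-fixpoint : ∀ x → φ (φ x) ≢ x
  φ²-no-fixpoint x = proj₂ (proj₂ (triangular x)) 2 (s≤s z≤n) (s≤s (s≤s (s≤s z≤n)))

  onTriangle-sym : ∀ {x y} → OnTriangle φ x y → OnTriangle φ y x
  onTriangle-sym (inj₁ refl)        = inj₁ refl
  onTriangle-sym (inj₂ (inj₁ refl)) = inj₂ (inj₂ (φ³ _))
  onTriangle-sym (inj₂ (inj₂ refl)) = inj₂ (inj₁ (φ³ _))

-- φ ∘ (p q) traverses the two triangles as one hexagon p, φ q, φ² q, q, φ p, φ² p.
module TriangleMerge {A : Set} (_≟_ : DecidableEquality A) (φ : A → A)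
  (triangular : ∀ x → OrbitLength φ x 3) (p q : A) (apart : ¬ OnTriangle φ p q) where
  open Transposition _≟_
  open Triangles φ triangular

  ψ : A → A
  ψ = φ ∘ swap p q

  ψ-other : ∀ {x} → x ≢ p → x ≢ q → ψ x ≡ φ x
  ψ-other x≢p x≢q = cong φ (swap-other [ x≢p , x≢q ])

  ψ-untouched : ∀ {x} → ¬ OnTriangle φ x p → ¬ OnTriangle φ x q → OrbitLength ψ x 3
  ψ-untouched {x} p∉ q∉ = s≤s z≤n , ψ³x≡x , minimal
    where
    ψ¹x : iter ψ 1 x ≡ φ x
    ψ¹x = ψ-other (p∉ ∘ inj₁) (q∉ ∘ inj₁)
    ψ²x : iter ψ 2 x ≡ φ (φ x)
    ψ²x = trans (cong ψ ψ¹x) (ψ-other (p∉ ∘ inj₂ ∘ inj₁) (q∉ ∘ inj₂ ∘ inj₁))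
    ψ³x≡x : iter ψ 3 x ≡ x
    ψ³x≡x = trans (cong ψ ψ²x) (trans (ψ-other (p∉ ∘ inj₂ ∘ inj₂) (q∉ ∘ inj₂ ∘ inj₂)) (φ³ x))
    minimal : ∀ j → 1 ≤ j → j < 3 → iter ψ j x ≢ x
    minimal 1 _ _ e = φ-no-fixpoint x (trans (sym ψ¹x) e)
    minimal 2 _ _ e = φ²-no-fixpoint x (trans (sym ψ²x) e)
    minimal (suc (suc (suc _))) _ (s≤s (s≤s (s≤s ())))

  apart′ : ¬ OnTriangle φ q p
  apart′ = apart ∘ onTriangle-sym

  ψ¹p : iter ψ 1 p ≡ φ q
  ψ¹p = cong φ (swap-a p q)

  ψ²p : iter ψ 2 p ≡ φ (φ q)
  ψ²p = trans (cong ψ ψ¹p) (ψ-other (apart′ ∘ inj₂ ∘ inj₁) (φ-no-fixpoint q))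

  ψ³p : iter ψ 3 p ≡ q
  ψ³p = trans (cong ψ ψ²p) (trans (ψ-other (apart′ ∘ inj₂ ∘ inj₂) (φ²-no-fixpoint q)) (φ³ q))

  ψ⁴p : iter ψ 4 p ≡ φ p
  ψ⁴p = trans (cong ψ ψ³p) (cong φ (swap-b p q))

  ψ⁵p : iter ψ 5 p ≡ φ (φ p)
  ψ⁵p = trans (cong ψ ψ⁴p) (ψ-other (φ-no-fixpoint p) (apart ∘ inj₂ ∘ inj₁))

  ψ⁶p : iter ψ 6 p ≡ p
  ψ⁶p = trans (cong ψ ψ⁵p) (trans (ψ-other (φ²-no-fixpoint p) (apart ∘ inj₂ ∘ inj₂)) (φ³ p))

  hexagon : OrbitLength ψ p 6
  hexagon = s≤s z≤n , ψ⁶p , minimal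
    where
    minimal : ∀ j → 1 ≤ j → j < 6 → iter ψ j p ≢ p
    minimal 1 _ _ e = apart′ (inj₂ (inj₁ (trans (sym ψ¹p) e)))
    minimal 2 _ _ e = apart′ (inj₂ (inj₂ (trans (sym ψ²p) e)))
    minimal 3 _ _ e = apart′ (inj₁ (trans (sym ψ³p) e))
    minimal 4 _ _ e = φ-no-fixpoint p (trans (sym ψ⁴p) e)
    minimal 5 _ _ e = φ²-no-fixpoint p (trans (sym ψ⁵p) e)
    minimal (suc (suc (suc (suc (suc (suc _)))))) _ (s≤s (s≤s (s≤s (s≤s (s≤s (s≤s ()))))))

  onTriangle? : ∀ x y → Dec (OnTriangle φ x y)
  onTriangle? x y = (x ≟ y) ⊎-dec (φ x ≟ y) ⊎-dec (φ (φ x) ≟ y)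

  hexagon-or-triangle : ∀ x → Reach ψ p x ⊎ OrbitLength ψ x 3
  hexagon-or-triangle x with onTriangle? p x | onTriangle? q x
  ... | yes (inj₁ e)        | _ = inj₁ (0 , e)
  ... | yes (inj₂ (inj₁ e)) | _ = inj₁ (4 , trans ψ⁴p e)
  ... | yes (inj₂ (inj₂ e)) | _ = inj₁ (5 , trans ψ⁵p e)
  ... | no _ | yes (inj₁ e)        = inj₁ (3 , trans ψ³p e)
  ... | no _ | yes (inj₂ (inj₁ e)) = inj₁ (1 , trans ψ¹p e)
  ... | no _ | yes (inj₂ (inj₂ e)) = inj₁ (2 , trans ψ²p e)
  ... | no p∉ | no q∉ = inj₂ (ψ-untouched (p∉ ∘ onTriangle-sym) (q∉ ∘ onTriangle-sym))

module _ {N : ℕ} (G : Graph N) where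
  open Graph G

  dart-≡ : ∀ {d e : Dart G} → tail G d ≡ tail G e → headD G d ≡ headD G e → d ≡ e
  dart-≡ {(u , v) , uv} {(.u , .v) , uv′} refl refl = cong ((u , v) ,_) (T-irrelevant uv uv′)

  _≟ᴰ_ : DecidableEquality (Dart G)
  _≟ᴰ_ = ≡-dec (≡-dec _≟_ _≟_) (λ uv uv′ → yes (T-irrelevant uv uv′))

  rev-injective : Injective _≡_ _≡_ (rev G)
  rev-injective e = dart-≡ (cong (headD G) e) (cong (tail G) e)

  adj-flip : ∀ {u v} → T (adj u v) → T (adj v u)
  adj-flip {u} {v} = subst T (adj-sym u v)

  rotationFibreCycles : RotationSystem G → FibreCycles (tail G)
  rotationFibreCycles R = record
    { σ = ρ ; σ⁻¹ = ρ⁻¹ ; σ-σ⁻¹ = ρ-inv₁ ; σ⁻¹-σ = ρ-inv₂ ; col-σ = ρ-tail ; σ-cyclic = ρ-cyclic }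
    where open RotationSystem R

  fibreCyclesRotation : FibreCycles (tail G) → RotationSystem G
  fibreCyclesRotation P = record
    { ρ = σ ; ρ⁻¹ = σ⁻¹ ; ρ-inv₁ = σ-σ⁻¹ ; ρ-inv₂ = σ⁻¹-σ ; ρ-tail = col-σ ; ρ-cyclic = σ-cyclic }
    where open FibreCycles P

  onTriangle-heads : (R : RotationSystem G) → let open RotationSystem R in
                   ∀ {d e} → φ (φ (φ d)) ≡ d → OnTriangle φ d e
                   → headD G d ≡ headD G e ⊎ T (adj (headD G d) (headD G e))
  onTriangle-heads R φ³d≡d (inj₁ refl) = inj₁ refl
  onTriangle-heads R {d} φ³d≡d (inj₂ (inj₁ refl)) =
    inj₂ (subst (λ u → T (adj u (headD G (φ d)))) (ρ-tail (rev G d)) (proj₂ (φ d)))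
    where open RotationSystem R
  onTriangle-heads R {d} φ³d≡d (inj₂ (inj₂ refl)) =
    inj₂ (subst (λ u → T (adj (headD G d) u)) tail-φ³d (adj-flip (proj₂ d)))
    where
    open RotationSystem R
    tail-φ³d : tail G d ≡ headD G (φ (φ d))
    tail-φ³d = trans (cong (tail G) (sym φ³d≡d)) (ρ-tail (rev G (φ (φ d))))

  module _ (E : OrientableEmbedding G) {A : Set} {f : A → A} (κ : A → Dart G) (β : Dart G → A)
           (κ∘β : ∀ d → κ (β d) ≡ d) (κ-injective : Injective _≡_ _≡_ κ)
           (φ∘κ≗κ∘f : ∀ x → OrientableEmbedding.φ E (κ x) ≡ κ (f x)) where

    type6-conjugate : ∀ p → OrbitLength f p 6 → (∀ x → Reach f p x ⊎ OrbitLength f x 3) → Type6 G E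
    type6-conjugate p hexagon others = κ p , orbitLength-map κ φ∘κ≗κ∘f κ-injective hexagon , face
      where
      open OrientableEmbedding E
      face : ∀ d → SameFace G E (κ p) d ⊎ FaceLength G E d 3
      face d with others (β d)
      ... | inj₁ p⇝βd = inj₁ (subst (Reach φ (κ p)) (κ∘β d) (reach-map κ φ∘κ≗κ∘f p⇝βd))
      ... | inj₂ △βd  = inj₂ (subst (λ e → OrbitLength φ e 3) (κ∘β d)
                                    (orbitLength-map κ φ∘κ≗κ∘f κ-injective △βd))

K-connected : ∀ n → Connected (K n)
K-connected n u v with u ≟ v
... | yes refl = ε
... | no u≢v   = fromWitnessFalse u≢v ◅ ε

module SplitContraction {m N : ℕ} (G : Graph N) (ℓ : Fin m ⊎ Fin 2 → Fin N)
  (ℓ-bijective : Bijective _≡_ _≡_ ℓ)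
  (clique : ∀ i j → i ≢ j → Graph.adj G (ℓ (inj₁ i)) (ℓ (inj₁ j)) ≡ true)
  (x₀≁x₁ : Graph.adj G (ℓ (inj₂ zero)) (ℓ (inj₂ (suc zero))) ≡ false)
  (partition : ∀ i → Graph.adj G (ℓ (inj₂ zero)) (ℓ (inj₁ i))
                     ≡ not (Graph.adj G (ℓ (inj₂ (suc zero))) (ℓ (inj₁ i))))
  where
  open Graph G

  x₀ x₁ : Fin N
  x₀ = ℓ (inj₂ zero)
  x₁ = ℓ (inj₂ (suc zero))

  IsX : Fin N → Set
  IsX p = p ∈[ x₀ , x₁ ]

  ℓ-injective : Injective _≡_ _≡_ ℓ
  ℓ-injective = proj₁ ℓ-bijective

  ℓ⁻¹ : Fin N → Fin m ⊎ Fin 2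
  ℓ⁻¹ p = proj₁ (proj₂ ℓ-bijective p)

  ℓ-ℓ⁻¹ : ∀ p → ℓ (ℓ⁻¹ p) ≡ p
  ℓ-ℓ⁻¹ p = proj₂ (proj₂ ℓ-bijective p) refl

  x₀≢x₁ : x₀ ≢ x₁
  x₀≢x₁ e with ℓ-injective e
  ... | ()

  ℓ-inj₂-IsX : ∀ s → IsX (ℓ (inj₂ s))
  ℓ-inj₂-IsX zero       = inj₁ refl
  ℓ-inj₂-IsX (suc zero) = inj₂ refl

  vertex-cases : ∀ p → (∃ λ i → ℓ (inj₁ i) ≡ p) ⊎ IsX p
  vertex-cases p with ℓ⁻¹ p | ℓ-ℓ⁻¹ p
  ... | inj₁ i | ℓi≡p = inj₁ (i , ℓi≡p)
  ... | inj₂ s | ℓs≡p = inj₂ (subst IsX ℓs≡p (ℓ-inj₂-IsX s))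

  X-independent : ∀ {p q} → IsX p → IsX q → ¬ T (adj p q)
  X-independent (inj₁ refl) (inj₁ refl) = subst T (adj-irrefl x₀)
  X-independent (inj₁ refl) (inj₂ refl) = subst T x₀≁x₁
  X-independent (inj₂ refl) (inj₁ refl) = subst T (trans (adj-sym x₁ x₀) x₀≁x₁)
  X-independent (inj₂ refl) (inj₂ refl) = subst T (adj-irrefl x₁)

  X-disjoint-neighbourhoods : ∀ {v} → T (adj x₀ v) → T (adj x₁ v) → ⊥
  X-disjoint-neighbourhoods {v} x₀~v x₁~v with vertex-cases v
  ... | inj₂ Xv = X-independent (inj₁ refl) Xv x₀~v
  ... | inj₁ (i , refl) with adj x₀ (ℓ (inj₁ i)) | adj x₁ (ℓ (inj₁ i)) | partition i
  ...   | true | true | ()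

  X-unique-neighbour : ∀ {p q v} → IsX p → IsX q → T (adj p v) → T (adj q v) → p ≡ q
  X-unique-neighbour (inj₁ refl) (inj₁ refl) _ _ = refl
  X-unique-neighbour (inj₂ refl) (inj₂ refl) _ _ = refl
  X-unique-neighbour (inj₁ refl) (inj₂ refl) x₀~v x₁~v = ⊥-elim (X-disjoint-neighbourhoods x₀~v x₁~v)
  X-unique-neighbour (inj₂ refl) (inj₁ refl) x₁~v x₀~v = ⊥-elim (X-disjoint-neighbourhoods x₀~v x₁~v)

  side : Fin m → Fin 2
  side i with adj x₀ (ℓ (inj₁ i))
  ... | true  = zero
  ... | false = suc zero

  side-adjacent : ∀ i → T (adj (ℓ (inj₂ (side i))) (ℓ (inj₁ i)))
  side-adjacent i with adj x₀ (ℓ (inj₁ i)) in x₀~i | adj x₁ (ℓ (inj₁ i)) in x₁~i | partition i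
  ... | true  | _     | _ = subst T (sym x₀~i) tt
  ... | false | true  | _ = subst T (sym x₁~i) tt
  ... | false | false | ()

  label : Fin m ⊎ Fin 2 → Fin (suc m)
  label (inj₁ i) = suc i
  label (inj₂ _) = zero

  identify : Fin N → Fin (suc m)
  identify p = label (ℓ⁻¹ p)

  identify-ℓ : ∀ X → identify (ℓ X) ≡ label X
  identify-ℓ X = cong label (ℓ-injective (ℓ-ℓ⁻¹ (ℓ X)))

  identify-x₀≡x₁ : identify x₀ ≡ identify x₁
  identify-x₀≡x₁ = trans (identify-ℓ _) (sym (identify-ℓ _))

  identify-fibres : ∀ {p q} → identify p ≡ identify q → p ≡ q ⊎ (IsX p × IsX q)
  identify-fibres {p} {q} e =
    subst₂ (λ u v → u ≡ v ⊎ (IsX u × IsX v)) (ℓ-ℓ⁻¹ p) (ℓ-ℓ⁻¹ q) (label-fibres (ℓ⁻¹ p) (ℓ⁻¹ q) e)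
    where
    label-fibres : ∀ X Y → label X ≡ label Y → ℓ X ≡ ℓ Y ⊎ (IsX (ℓ X) × IsX (ℓ Y))
    label-fibres (inj₁ i) (inj₁ j) e = inj₁ (cong (ℓ ∘ inj₁) (suc-injective e))
    label-fibres (inj₂ s) (inj₂ t) _ = inj₂ (ℓ-inj₂-IsX s , ℓ-inj₂-IsX t)

  identify-adjacent : ∀ {p q} → T (adj p q) → identify p ≢ identify q
  identify-adjacent {p} {q} p~q e with identify-fibres e
  ... | inj₁ refl        = subst T (adj-irrefl p) p~q
  ... | inj₂ (Xp , Xq)   = X-independent Xp Xq p~q

  identify-tails : ∀ {p q p′ q′} → T (adj p q) → T (adj p′ q′)
                 → identify p ≡ identify p′ → identify q ≡ identify q′ → p ≡ p′
  identify-tails p~q p′~q′ ip≡ip′ iq≡iq′ with identify-fibres ip≡ip′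
  ... | inj₁ p≡p′ = p≡p′
  ... | inj₂ (Xp , Xp′) with identify-fibres iq≡iq′
  ...   | inj₁ refl     = X-unique-neighbour Xp Xp′ p~q p′~q′
  ...   | inj₂ (Xq , _) = ⊥-elim (X-independent Xp Xq p~q)

  -- A K-vertex u seen from its neighbour v: the x-vertex adjacent to v stands for u = 0.
  lift : Fin (suc m) → Fin (suc m) → Fin N
  lift (suc i) _       = ℓ (inj₁ i)
  lift zero    (suc j) = ℓ (inj₂ (side j))
  lift zero    zero    = x₀

  identify-lift : ∀ u v → identify (lift u v) ≡ u
  identify-lift (suc i) _       = identify-ℓ (inj₁ i)
  identify-lift zero    (suc j) = identify-ℓ (inj₂ (side j))
  identify-lift zero    zero    = identify-ℓ (inj₂ zero)

  lift-adjacent : ∀ {u v} → u ≢ v → T (adj (lift u v) (lift v u))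
  lift-adjacent {zero}  {zero}  u≢v = ⊥-elim (u≢v refl)
  lift-adjacent {zero}  {suc j} _   = side-adjacent j
  lift-adjacent {suc i} {zero}  _   = adj-flip G (side-adjacent i)
  lift-adjacent {suc i} {suc j} u≢v = subst T (sym (clique i j (u≢v ∘ cong suc))) tt

  contract : Dart G → Dart (K (suc m))
  contract ((p , q) , p~q) = (identify p , identify q) , fromWitnessFalse (identify-adjacent p~q)

  expand : Dart (K (suc m)) → Dart G
  expand ((u , v) , u≢v) = (lift u v , lift v u) , lift-adjacent (toWitnessFalse u≢v)

  contract-expand : ∀ d → contract (expand d) ≡ d
  contract-expand ((u , v) , _) = dart-≡ (K (suc m)) (identify-lift u v) (identify-lift v u)

  contract-injective : Injective _≡_ _≡_ contract
  contract-injective {(p , q) , p~q} {(p′ , q′) , p′~q′} e = dart-≡ G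
    (identify-tails p~q p′~q′ (cong (tail (K _)) e) (cong (headD (K _)) e))
    (identify-tails (adj-flip G p~q) (adj-flip G p′~q′) (cong (headD (K _)) e) (cong (tail (K _)) e))

  expand-contract : ∀ d → expand (contract d) ≡ d
  expand-contract d = contract-injective (contract-expand (contract d))

  contract-rev : ∀ d → contract (rev G d) ≡ rev (K (suc m)) (contract d)
  contract-rev d = dart-≡ (K (suc m)) refl refl

  module Spliced (E : OrientableEmbedding G) (triangular : Triangular G E)
    (i₀ : Fin m) (x₀~i₀ : adj x₀ (ℓ (inj₁ i₀)) ≡ true)
    (i₁ : Fin m) (x₁~i₁ : adj x₁ (ℓ (inj₁ i₁)) ≡ true) where
    open OrientableEmbedding E
    open Transposition (_≟ᴰ_ G)

    A B : Dart G
    A = (ℓ (inj₁ i₀) , x₀) , adj-flip G (subst T (sym x₀~i₀) tt)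
    B = (ℓ (inj₁ i₁) , x₁) , adj-flip G (subst T (sym x₁~i₁) tt)

    A-B-apart : ¬ OnTriangle φ A B
    A-B-apart A~B with onTriangle-heads G rot (proj₁ (proj₂ (triangular A))) A~B
    ... | inj₁ x₀≡x₁ = x₀≢x₁ x₀≡x₁
    ... | inj₂ x₀~x₁ = X-independent (inj₁ refl) (inj₂ refl) x₀~x₁

    open Splice (_≟ᴰ_ G) (rotationFibreCycles G rot) (rev G A) (rev G B) x₀≢x₁
                identify identify-x₀≡x₁ identify-fibres
      using (g; spliced)
    open TriangleMerge (_≟ᴰ_ G) φ triangular A B A-B-apart
      using (ψ; hexagon; hexagon-or-triangle)

    rotK : RotationSystem (K (suc m))
    rotK = fibreCyclesRotation (K (suc m))
             (transportFibreCycles contract expand contract-expand expand-contract (λ _ → refl) spliced)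

    EK : OrientableEmbedding (K (suc m))
    EK = record { connected = K-connected (suc m) ; rot = rotK }

    φK-contract : ∀ d → OrientableEmbedding.φ EK (contract d) ≡ contract (ψ d)
    φK-contract d = begin
      contract (g (expand (rev (K (suc m)) (contract d))))
        ≡⟨ cong (contract ∘ g ∘ expand) (contract-rev d) ⟨
      contract (g (expand (contract (rev G d))))
        ≡⟨ cong (contract ∘ g) (expand-contract (rev G d)) ⟩
      contract (ρ (swap (rev G A) (rev G B) (rev G d)))
        ≡⟨ cong (contract ∘ ρ) (swap-natural (rev-injective G) A B d) ⟨
      contract (ψ d) ∎
      where open ≡-Reasoning

    -- f is given: solving contract (f x) = contract (ψ x) by unification would unfold contract.
    type6 : Type6 (K (suc m)) EK
    type6 = type6-conjugate (K (suc m)) EK {f = ψ} contract expand contract-expand contract-injective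
              φK-contract A hexagon hexagon-or-triangle

mainTheorem6 : (n N : ℕ) (G : Graph N) → IsSplitComplete n G
    → (∃ λ (E : OrientableEmbedding G) → Triangular G E)
    → ∃ λ (E : OrientableEmbedding (K n)) → Type6 (K n) E
mainTheorem6 zero    N G (_ , _ , _ , _ , _ , (() , _) , _) _
mainTheorem6 (suc m) N G (ℓ , ℓ-bijective , clique , x₀≁x₁ , partition , (i₀ , x₀~i₀) , (i₁ , x₁~i₁))
             (E , triangular) = EK , type6
  where
  -- m is given explicitly: inferred from ℓ it would be suc m ∸ 1, and checking
  -- Type6 (K (suc (suc m ∸ 1))) against Type6 (K (suc m)) unfolds every face.
  open SplitContraction {m} G ℓ ℓ-bijective clique x₀≁x₁ partition
  open Spliced E triangular i₀ x₀~i₀ i₁ x₁~i₁
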